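{- Let $m,n\geq2$ and $i,j\in\{1,2\}$. Then $P_{i,j}(T,m\times n)=\bigcup_{k,l\in\{0,2\}}Q_{i+k,j+l}(T,m\times n)$, and the four sets $Q_{i+k,j+l}(T,m\times n)$, $k,l\in\{0,2\}$, are non-empty and pairwise disjoint.
   Context: Let $\mathcal{A}=\{\mathtt{A},\dots,\mathtt{P}\}$. The substitution $\mu$ maps each letter to a $2\times2$ block over $\mathcal{A}$ (written (first row / second row)): $\mathtt{A}\mapsto(\mathtt{AF}/\mathtt{GC})$, $\mathtt{B}\mapsto(\mathtt{AF}/\mathtt{HD})$, $\mathtt{C}\mapsto(\mathtt{BE}/\mathtt{GC})$, $\mathtt{D}\mapsto(\mathtt{BE}/\mathtt{HD})$, $\mathtt{E}\mapsto(\mathtt{AN}/\mathtt{GK})$, $\mathtt{F}\mapsto(\mathtt{AN}/\mathtt{HL})$, $\mathtt{G}\mapsto(\mathtt{BM}/\mathtt{GK})$, $\mathtt{H}\mapsto(\mathtt{BM}/\mathtt{HL})$, $\mathtt{I}\mapsto(\mathtt{IF}/\mathtt{OC})$, $\mathtt{J}\mapsto(\mathtt{IF}/\mathtt{PD})$, $\mathtt{K}\mapsto(\mathtt{JE}/\mathtt{OC})$, $\mathtt{L}\mapsto(\mathtt{JE}/\mathtt{PD})$, $\mathtt{M}\mapsto(\mathtt{IN}/\mathtt{OK})$, $\mathtt{N}\mapsto(\mathtt{IN}/\mathtt{PL})$, $\mathtt{O}\mapsto(\mathtt{JM}/\mathtt{OK})$, $\mathtt{P}\mapsto(\mathtt{JM}/\mathtt{PL})$.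 For a matrix $X$ over $\mathcal{A}$, $\mu(X)$ replaces each entry by its $2\times2$ block; $\mu^0=\mathrm{id}$, $\mu^k=\mu^{k-1}\circ\mu$; $T_k:=\mu^k(\mathtt{N})$. For a matrix $X$, $X[r,c,m\times n]$ is its $m\times n$ contiguous submatrix with upper-left corner at row $r$, column $c$; $P(X,m\times n)$ is the set of all its $m\times n$ contiguous submatrices; $P(T,m\times n):=\bigcup_{k\ge0}P(T_k,m\times n)$. For $i,j\in\{1,2\}$, $P_{i,j}(T,m\times n):=\{\mu(x)[i,j,m\times n]: x\in P(T,m\times n)\}$. For $i,j\in\{1,2,3,4\}$, $Q_{i,j}(T,m\times n):=\{\mu^2(x)[i,j,m\times n]: x\in P(T,m\times n)\}$. -}

module Defs where

open import Data.Nat using (ℕ; zero; suc; _+_; _*_; _≤_; _<_)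
open import Data.Nat.DivMod using (_/_; _mod_)
open import Data.Fin using (Fin) renaming (zero to f0; suc to fs)
open import Data.Product using (Σ; ∃; _×_)
open import Relation.Binary.PropositionalEquality using (_≡_)

data Letter : Set where
  A B C D E F G H I J K L M N O P : Letter

-- Two-by-two blocks: block x r c is the entry in row r, column c (0-based)
-- of the 2x2 block mu(x).
mkBlock : Letter → Letter → Letter → Letter → Fin 2 → Fin 2 → Letter
mkBlock a b c d f0      f0      = a
mkBlock a b c d f0      (fs _)  = b
mkBlock a b c d (fs _)  f0      = c
mkBlock a b c d (fs _)  (fs _)  = d

block : Letter → Fin 2 → Fin 2 → Letter
block A = mkBlock A F G C
block B = mkBlock A F H D
block C = mkBlock B E G C
block D = mkBlock B E H D
block E = mkBlock A N G K
block F = mkBlock A N H L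
block G = mkBlock B M G K
block H = mkBlock B M H L
block I = mkBlock I F O C
block J = mkBlock I F P D
block K = mkBlock J E O C
block L = mkBlock J E P D
block M = mkBlock I N O K
block N = mkBlock I N P L
block O = mkBlock J M O K
block P = mkBlock J M P L

-- A (finite) matrix over the alphabet: its numbers of rows and columns,
-- and its entries, indexed 0-based (only entries with row < rows and
-- column < cols are meaningful).
record Mat : Set where
  constructor mat
  field
    rows : ℕ
    cols : ℕ
    at   : ℕ → ℕ → Letter
open Mat public

_≈_ : Mat → Mat → Set
X ≈ Y = (rows X ≡ rows Y) × (cols X ≡ cols Y) ×
        (∀ a b → a < rows X → b < cols X → at X a b ≡ at Y a b)

μ : Mat → Mat
μ X = mat (2 * rows X) (2 * cols X)
          (λ p q → block (at X (p / 2) (q / 2)) (p mod 2) (q mod 2))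

μ^ : ℕ → Mat → Mat
μ^ zero    X = X
μ^ (suc k) X = μ^ k (μ X)

single : Letter → Mat
single x = mat 1 1 (λ _ _ → x)

T : ℕ → Mat
T k = μ^ k (single N)

-- Contiguous submatrix with upper-left corner at 0-based position (r , c)
-- of size m x n; i.e. X[r+1, c+1, m x n] in the paper's 1-based notation.
sub : Mat → ℕ → ℕ → ℕ → ℕ → Mat
sub X r c m n = mat m n (λ a b → at X (r + a) (c + b))

Pat : Mat → ℕ → ℕ → Mat → Set
Pat X m n Y = Σ ℕ λ r → Σ ℕ λ c →
  (r + m ≤ rows X) × (c + n ≤ cols X) × (Y ≈ sub X r c m n)

PT : ℕ → ℕ → Mat → Set
PT m n Y = ∃ λ k → Pat (T k) m n Y

-- P_{i,j}(T, m x n), with 0-based offsets i j (paper's index i+1, j+1).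
Pij : ℕ → ℕ → ℕ → ℕ → Mat → Set
Pij i j m n Y = Σ Mat λ x → PT m n x × (Y ≈ sub (μ x) i j m n)

-- Q_{i,j}(T, m x n), with 0-based offsets i j (paper's index i+1, j+1).
Qij : ℕ → ℕ → ℕ → ℕ → Mat → Set
Qij i j m n Y = Σ Mat λ x → PT m n x × (Y ≈ sub (μ^ 2 x) i j m n)

{-# OPTIONS --safe #-}
-- Windows of μ²(x) at offset (i + 2k, j + 2l) are windows of μ(x′) at offset (i, j), where x′ is
-- the window of μ(x) at (k, l). Conversely, a pattern x lying in the top-left quadrant of some
-- μ(Z) is the window at (k, l) of μ(x″) for a pattern x″ of Z, so μ(x) at (i, j) is μ²(x″) at
-- (i + 2k, j + 2l); every pattern of T h has a copy in the top-left quadrant of T (3 + h).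
-- Disjointness is recognisability: each letter determines its position in its 2×2 block, and the
-- top-right letter of a block determines the position of the letter it came from, so the entry
-- at (i, 1 − j) of the window determines k and l.
module Submission where

open import Defs
open import Data.Nat using (ℕ; zero; suc; _+_; _*_; _^_; _∸_; _≤_; _<_; z≤n; s≤s)
open import Data.Nat.Properties
open import Data.Nat.DivMod using (_/_; _%_; _mod_; m≡m%n+[m/n]*n; m/n≤m; m<n*o⇒m/o<n; %-remove-+ˡ; +-distrib-/-∣ˡ; m*n/n≡m)
open import Data.Nat.Divisibility using (m∣m*n)
open import Data.Nat.Tactic.RingSolver using (solve-∀)
open import Data.Fin using (Fin; toℕ) renaming (zero to f0; suc to fs)
open import Data.Fin.Properties using (toℕ-fromℕ<; fromℕ<-cong; toℕ<n; toℕ≤pred[n])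
open import Data.Product using (Σ; ∃; _×_; _,_; proj₁; proj₂)
open import Data.Sum using (_⊎_; inj₁; inj₂)
open import Data.Empty using (⊥)
open import Relation.Binary.Bundles using (Setoid)
open import Relation.Binary.PropositionalEquality
import Relation.Binary.Reasoning.Setoid as SetoidReasoning

≈-refl : ∀ {X} → X ≈ X
≈-refl = refl , refl , λ _ _ _ _ → refl

≈-sym : ∀ {X Y} → X ≈ Y → Y ≈ X
≈-sym (r≡ , c≡ , at≡) =
  sym r≡ , sym c≡ , λ a b a< b< → sym (at≡ a b (subst (a <_) (sym r≡) a<) (subst (b <_) (sym c≡) b<))

≈-trans : ∀ {X Y Z} → X ≈ Y → Y ≈ Z → X ≈ Z
≈-trans (r≡ , c≡ , at≡) (r≡′ , c≡′ , at≡′) =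
  trans r≡ r≡′ , trans c≡ c≡′ ,
  λ a b a< b< → trans (at≡ a b a< b<) (at≡′ a b (subst (a <_) r≡ a<) (subst (b <_) c≡ b<))

≈-setoid : Setoid _ _
≈-setoid = record
  { Carrier = Mat
  ; _≈_ = _≈_
  ; isEquivalence = record { refl = ≈-refl ; sym = ≈-sym ; trans = ≈-trans }
  }

sub-cong : ∀ {X Y} r c m n → r + m ≤ rows X → c + n ≤ cols X → X ≈ Y →
           sub X r c m n ≈ sub Y r c m n
sub-cong r c m n r+m≤ c+n≤ (_ , _ , at≡) =
  refl , refl ,
  λ a b a<m b<n → at≡ (r + a) (c + b) (<-≤-trans (+-monoʳ-< r a<m) r+m≤) (<-≤-trans (+-monoʳ-< c b<n) c+n≤)

sub-sub : ∀ X r c m n r′ c′ m′ n′ →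
          sub (sub X r c m n) r′ c′ m′ n′ ≈ sub X (r + r′) (c + c′) m′ n′
sub-sub X r c m n r′ c′ m′ n′ =
  refl , refl , λ a b _ _ → cong₂ (at X) (sym (+-assoc r r′ a)) (sym (+-assoc c c′ b))

Pat-sub : ∀ {X x} Z a b R S m n → X ≈ sub Z a b R S → a + R ≤ rows Z → b + S ≤ cols Z →
          Pat X m n x → Pat Z m n x
Pat-sub {X} {x} Z a b R S m n X≈ a+R≤ b+S≤ (r , c , r+m≤ , c+n≤ , x≈) =
  a + r , b + c , shift a r m R (proj₁ X≈) r+m≤ a+R≤ , shift b c n S (proj₁ (proj₂ X≈)) c+n≤ b+S≤ ,
  (begin
    x                             ≈⟨ x≈ ⟩
    sub X r c m n                 ≈⟨ sub-cong r c m n r+m≤ c+n≤ X≈ ⟩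
    sub (sub Z a b R S) r c m n   ≈⟨ sub-sub Z a b R S r c m n ⟩
    sub Z (a + r) (b + c) m n     ∎)
  where
  open SetoidReasoning ≈-setoid
  shift : ∀ a r m R {R′ U} → R′ ≡ R → r + m ≤ R′ → a + R ≤ U → a + r + m ≤ U
  shift a r m R refl r+m≤ a+R≤ = ≤-trans (≤-reflexive (+-assoc a r m)) (≤-trans (+-monoʳ-≤ a r+m≤) a+R≤)

half< : ∀ {p m} → p < 2 * m → p / 2 < m
half< {p} {m} p<2m = m<n*o⇒m/o<n (subst (p <_) (*-comm 2 m) p<2m)

μ-cong : ∀ {X Y} → X ≈ Y → μ X ≈ μ Y
μ-cong (r≡ , c≡ , at≡) =
  cong (2 *_) r≡ , cong (2 *_) c≡ ,
  λ p q p< q< → cong (λ z → block z (p mod 2) (q mod 2)) (at≡ (p / 2) (q / 2) (half< p<) (half< q<))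

[2r+p]/2≡r+p/2 : ∀ r p → (2 * r + p) / 2 ≡ r + p / 2
[2r+p]/2≡r+p/2 r p = trans (+-distrib-/-∣ˡ p (m∣m*n r)) (cong (_+ p / 2) (trans (cong (_/ 2) (*-comm 2 r)) (m*n/n≡m r 2)))

[2r+p]mod2≡pmod2 : ∀ r p → (2 * r + p) mod 2 ≡ p mod 2
[2r+p]mod2≡pmod2 r p = fromℕ<-cong _ _ (%-remove-+ˡ p (m∣m*n r)) _ _

at-μ : ∀ X r c p q → at (μ X) (2 * r + p) (2 * c + q) ≡ block (at X (r + p / 2) (c + q / 2)) (p mod 2) (q mod 2)
at-μ X r c p q =
  trans (cong₂ (λ u v → block (at X u v) ((2 * r + p) mod 2) ((2 * c + q) mod 2)) ([2r+p]/2≡r+p/2 r p) ([2r+p]/2≡r+p/2 c q))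
        (cong₂ (block (at X (r + p / 2) (c + q / 2))) ([2r+p]mod2≡pmod2 r p) ([2r+p]mod2≡pmod2 c q))

μ-sub : ∀ X r c m n → μ (sub X r c m n) ≈ sub (μ X) (2 * r) (2 * c) (2 * m) (2 * n)
μ-sub X r c m n = refl , refl , λ p q _ _ → sym (at-μ X r c p q)

doubled-window-fits : ∀ {i m} r R → i ≤ m → r + m ≤ R → 2 * r + i + m ≤ 2 * R
doubled-window-fits {i} {m} r R i≤m r+m≤R = begin
  2 * r + i + m   ≤⟨ +-monoˡ-≤ m (+-monoʳ-≤ (2 * r) i≤m) ⟩
  2 * r + m + m   ≡⟨ double r m ⟩
  2 * (r + m)     ≤⟨ *-monoʳ-≤ 2 r+m≤R ⟩
  2 * R           ∎
  where
  open ≤-Reasoning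
  double : ∀ r m → 2 * r + m + m ≡ 2 * (r + m)
  double = solve-∀

sub-μ : ∀ {x} X r c i j m n → x ≈ sub X r c m n → i ≤ m → j ≤ n →
        sub (μ x) i j m n ≈ sub (μ X) (2 * r + i) (2 * c + j) m n
sub-μ {x} X r c i j m n x≈ i≤m j≤n = begin
  sub (μ x) i j m n                                         ≈⟨ sub-cong i j m n i+m≤ j+n≤ (μ-cong (≈-sym x≈)) ⟨
  sub (μ (sub X r c m n)) i j m n                           ≈⟨ sub-cong i j m n i+m≤ j+n≤ (μ-sub X r c m n) ⟩
  sub (sub (μ X) (2 * r) (2 * c) (2 * m) (2 * n)) i j m n   ≈⟨ sub-sub (μ X) (2 * r) (2 * c) (2 * m) (2 * n) i j m n ⟩
  sub (μ X) (2 * r + i) (2 * c + j) m n                     ∎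
  where
  open SetoidReasoning ≈-setoid
  i+m≤ : i + m ≤ 2 * m
  i+m≤ = doubled-window-fits 0 m i≤m ≤-refl
  j+n≤ : j + n ≤ 2 * n
  j+n≤ = doubled-window-fits 0 n j≤n ≤-refl

μ^-suc : ∀ h X → μ^ (suc h) X ≡ μ (μ^ h X)
μ^-suc zero    X = refl
μ^-suc (suc h) X = μ^-suc h (μ X)

T-suc : ∀ h → T (suc h) ≡ μ (T h)
T-suc h = μ^-suc h (single N)

rows-T : ∀ h → rows (T h) ≡ 2 ^ h
rows-T zero    = refl
rows-T (suc h) = trans (cong rows (T-suc h)) (cong (2 *_) (rows-T h))

cols-T : ∀ h → cols (T h) ≡ 2 ^ h
cols-T zero    = refl
cols-T (suc h) = trans (cong cols (T-suc h)) (cong (2 *_) (cols-T h))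

Fin2-toℕ≤ : ∀ {m} (k : Fin 2) → 1 ≤ m → toℕ k ≤ m
Fin2-toℕ≤ k 1≤m = ≤-trans (toℕ≤pred[n] k) 1≤m

topLeftQuadrant : Mat → Mat
topLeftQuadrant Z = sub (μ Z) 0 0 (rows Z) (cols Z)

r≡2[r/2]+rmod2 : ∀ r → r ≡ 2 * (r / 2) + toℕ (r mod 2)
r≡2[r/2]+rmod2 r =
  trans (m≡m%n+[m/n]*n r 2) (trans (+-comm (r % 2) _) (cong₂ _+_ (*-comm (r / 2) 2) (sym (toℕ-fromℕ< _))))

Pat-topLeftQuadrant⇒μ-window : ∀ Z {x m n} → 1 ≤ m → 1 ≤ n → Pat (topLeftQuadrant Z) m n x →
  Σ Mat λ x″ → Pat Z m n x″ × Σ (Fin 2) λ k → Σ (Fin 2) λ l → x ≈ sub (μ x″) (toℕ k) (toℕ l) m n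
Pat-topLeftQuadrant⇒μ-window Z {x} {m} {n} 1≤m 1≤n (r , c , r+m≤ , c+n≤ , x≈) =
  sub Z (r / 2) (c / 2) m n ,
  (r / 2 , c / 2 , halve r m r+m≤ , halve c n c+n≤ , ≈-refl) ,
  r mod 2 , c mod 2 ,
  (begin
    x                                                                          ≈⟨ x≈ ⟩
    sub (topLeftQuadrant Z) r c m n                                            ≈⟨ sub-sub (μ Z) 0 0 (rows Z) (cols Z) r c m n ⟩
    sub (μ Z) r c m n                                                          ≡⟨ cong₂ (λ u v → sub (μ Z) u v m n) (r≡2[r/2]+rmod2 r) (r≡2[r/2]+rmod2 c) ⟩
    sub (μ Z) (2 * (r / 2) + toℕ (r mod 2)) (2 * (c / 2) + toℕ (c mod 2)) m n  ≈⟨ sub-μ Z (r / 2) (c / 2) _ _ m n ≈-refl (Fin2-toℕ≤ (r mod 2) 1≤m) (Fin2-toℕ≤ (c mod 2) 1≤n) ⟨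
    sub (μ (sub Z (r / 2) (c / 2) m n)) (toℕ (r mod 2)) (toℕ (c mod 2)) m n    ∎)
  where
  open SetoidReasoning ≈-setoid
  halve : ∀ r m {R} → r + m ≤ R → r / 2 + m ≤ R
  halve r m r+m≤ = ≤-trans (+-monoˡ-≤ m (m/n≤m r 2)) r+m≤

-- T₃ has the letter N at (0, 3); the resulting copy of T h lies in the top-left quadrant of T (3 + h).
T-embed : ∀ h → Σ ℕ λ c → c + 2 ^ h ≤ 2 ^ (2 + h) × T h ≈ sub (T (3 + h)) 0 c (2 ^ h) (2 ^ h)
T-embed zero    = 3 , ≤-refl , (refl , refl , N-at-0-3)
  where
  N-at-0-3 : ∀ a b → a < 1 → b < 1 → at (T 0) a b ≡ at (T 3) a (3 + b)
  N-at-0-3 zero    zero    _         _         = refl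
  N-at-0-3 (suc _) _       (s≤s ()) _
  N-at-0-3 zero    (suc _) _         (s≤s ())
T-embed (suc h) with T-embed h
... | c , c+≤ , T≈ = 2 * c , c′+≤ , (begin
    T (suc h)                                                ≡⟨ T-suc h ⟩
    μ (T h)                                                  ≈⟨ μ-cong T≈ ⟩
    μ (sub (T (3 + h)) 0 c (2 ^ h) (2 ^ h))                   ≈⟨ μ-sub (T (3 + h)) 0 c (2 ^ h) (2 ^ h) ⟩
    sub (μ (T (3 + h))) 0 (2 * c) (2 ^ suc h) (2 ^ suc h)     ≡⟨ cong (λ W → sub W 0 (2 * c) (2 ^ suc h) (2 ^ suc h)) (T-suc (3 + h)) ⟨
    sub (T (3 + suc h)) 0 (2 * c) (2 ^ suc h) (2 ^ suc h)     ∎)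
  where
  open SetoidReasoning ≈-setoid
  c′+≤ : 2 * c + 2 ^ suc h ≤ 2 ^ (2 + suc h)
  c′+≤ = ≤-trans (≤-reflexive (sym (*-distribˡ-+ 2 c (2 ^ h)))) (*-monoʳ-≤ 2 c+≤)

Pat-T⇒Pat-topLeftQuadrant : ∀ h {m n x} → Pat (T h) m n x → Pat (topLeftQuadrant (T (2 + h))) m n x
Pat-T⇒Pat-topLeftQuadrant h {m} {n} with T-embed h
... | c , c+≤ , T≈ = Pat-sub (topLeftQuadrant Z) 0 c (2 ^ h) (2 ^ h) m n T≈′ rows-fit cols-fit
  where
  open SetoidReasoning ≈-setoid
  Z : Mat
  Z = T (2 + h)
  T≈′ : T h ≈ sub (topLeftQuadrant Z) 0 c (2 ^ h) (2 ^ h)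
  T≈′ = begin
    T h                                          ≈⟨ T≈ ⟩
    sub (T (3 + h)) 0 c (2 ^ h) (2 ^ h)           ≡⟨ cong (λ W → sub W 0 c (2 ^ h) (2 ^ h)) (T-suc (2 + h)) ⟩
    sub (μ Z) 0 c (2 ^ h) (2 ^ h)                 ≈⟨ sub-sub (μ Z) 0 0 (rows Z) (cols Z) 0 c (2 ^ h) (2 ^ h) ⟨
    sub (topLeftQuadrant Z) 0 c (2 ^ h) (2 ^ h)   ∎
  rows-fit : 2 ^ h ≤ rows Z
  rows-fit = ≤-trans (^-monoʳ-≤ 2 (m≤n+m h 2)) (≤-reflexive (sym (rows-T (2 + h))))
  cols-fit : c + 2 ^ h ≤ cols Z
  cols-fit = ≤-trans c+≤ (≤-reflexive (sym (cols-T (2 + h))))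

Pij⊆⋃Qij : ∀ {m n} i j → 1 ≤ m → 1 ≤ n → i ≤ m → j ≤ n → ∀ Y → Pij i j m n Y →
  Σ (Fin 2) λ k → Σ (Fin 2) λ l → Qij (i + 2 * toℕ k) (j + 2 * toℕ l) m n Y
Pij⊆⋃Qij {m} {n} i j 1≤m 1≤n i≤m j≤n Y (x , (h , x∈T) , Y≈)
  with Pat-topLeftQuadrant⇒μ-window (T (2 + h)) 1≤m 1≤n (Pat-T⇒Pat-topLeftQuadrant h x∈T)
... | x″ , x″∈T , k , l , x≈ = k , l , x″ , (2 + h , x″∈T) , (begin
    Y                                                     ≈⟨ Y≈ ⟩
    sub (μ x) i j m n                                     ≈⟨ sub-μ (μ x″) (toℕ k) (toℕ l) i j m n x≈ i≤m j≤n ⟩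
    sub (μ (μ x″)) (2 * toℕ k + i) (2 * toℕ l + j) m n     ≡⟨ cong₂ (λ u v → sub (μ (μ x″)) u v m n) (+-comm _ i) (+-comm _ j) ⟩
    sub (μ (μ x″)) (i + 2 * toℕ k) (j + 2 * toℕ l) m n     ∎)
  where open SetoidReasoning ≈-setoid

Qij⊆Pij : ∀ {m n} i j k l → i ≤ m → j ≤ n → k ≤ m → l ≤ n → ∀ Y →
  Qij (i + 2 * k) (j + 2 * l) m n Y → Pij i j m n Y
Qij⊆Pij {m} {n} i j k l i≤m j≤n k≤m l≤n Y (x , (h , r , c , r+m≤ , c+n≤ , x≈) , Y≈) =
  x′ , (suc h , x′∈T) , (begin
    Y                                           ≈⟨ Y≈ ⟩
    sub (μ (μ x)) (i + 2 * k) (j + 2 * l) m n   ≡⟨ cong₂ (λ u v → sub (μ (μ x)) u v m n) (+-comm i _) (+-comm j _) ⟩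
    sub (μ (μ x)) (2 * k + i) (2 * l + j) m n   ≈⟨ sub-μ (μ x) k l i j m n x′≈ i≤m j≤n ⟨
    sub (μ x′) i j m n                          ∎)
  where
  open SetoidReasoning ≈-setoid
  x′ : Mat
  x′ = sub (μ (T h)) (2 * r + k) (2 * c + l) m n
  x′≈ : x′ ≈ sub (μ x) k l m n
  x′≈ = ≈-sym (sub-μ (T h) r c k l m n x≈ k≤m l≤n)
  x′∈T : Pat (T (suc h)) m n x′
  x′∈T = subst (λ W → Pat W m n x′) (sym (T-suc h))
    (2 * r + k , 2 * c + l , doubled-window-fits r _ k≤m r+m≤ , doubled-window-fits c _ l≤n c+n≤ , ≈-refl)

n<2^n : ∀ n → n < 2 ^ n
n<2^n zero    = s≤s z≤n
n<2^n (suc n) = +-mono-≤ (m^n>0 2 n) (≤-trans (n<2^n n) (m≤m+n (2 ^ n) 0))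

Qij-nonempty : ∀ a b m n → ∃ λ Y → Qij a b m n Y
Qij-nonempty a b m n =
  sub (μ^ 2 x) a b m n , x ,
  (m + n , 0 , 0 ,
   ≤-trans (fits (m≤m+n m n)) (≤-reflexive (sym (rows-T (m + n)))) ,
   ≤-trans (fits (m≤n+m n m)) (≤-reflexive (sym (cols-T (m + n)))) , ≈-refl) ,
  ≈-refl
  where
  x : Mat
  x = sub (T (m + n)) 0 0 m n
  fits : ∀ {d} → d ≤ m + n → d ≤ 2 ^ (m + n)
  fits {d} d≤ = <⇒≤ (<-≤-trans (n<2^n d) (^-monoʳ-≤ 2 d≤))

position : Letter → Fin 2 × Fin 2
position A = f0 , f0
position B = f0 , f0
position C = fs f0 , fs f0
position D = fs f0 , fs f0
position E = f0 , fs f0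
position F = f0 , fs f0
position G = fs f0 , f0
position H = fs f0 , f0
position I = f0 , f0
position J = f0 , f0
position K = fs f0 , fs f0
position L = fs f0 , fs f0
position M = f0 , fs f0
position N = f0 , fs f0
position O = fs f0 , f0
position P = fs f0 , f0

position-mkBlock : ∀ {a b c d} →
  position a ≡ (f0 , f0) → position b ≡ (f0 , fs f0) →
  position c ≡ (fs f0 , f0) → position d ≡ (fs f0 , fs f0) →
  ∀ r s → position (mkBlock a b c d r s) ≡ (r , s)
position-mkBlock pa _  _  _  f0      f0      = pa
position-mkBlock _  pb _  _  f0      (fs f0) = pb
position-mkBlock _  _  pc _  (fs f0) f0      = pc
position-mkBlock _  _  _  pd (fs f0) (fs f0) = pd

position-block : ∀ z r s → position (block z r s) ≡ (r , s)
position-block A = position-mkBlock refl refl refl refl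
position-block B = position-mkBlock refl refl refl refl
position-block C = position-mkBlock refl refl refl refl
position-block D = position-mkBlock refl refl refl refl
position-block E = position-mkBlock refl refl refl refl
position-block F = position-mkBlock refl refl refl refl
position-block G = position-mkBlock refl refl refl refl
position-block H = position-mkBlock refl refl refl refl
position-block I = position-mkBlock refl refl refl refl
position-block J = position-mkBlock refl refl refl refl
position-block K = position-mkBlock refl refl refl refl
position-block L = position-mkBlock refl refl refl refl
position-block M = position-mkBlock refl refl refl refl
position-block N = position-mkBlock refl refl refl refl
position-block O = position-mkBlock refl refl refl refl
position-block P = position-mkBlock refl refl refl refl

-- Only meaningful on the letters F, N, M, E that occur at the top-right of a block.
parentPosition : Letter → Fin 2 × Fin 2
parentPosition F = f0 , f0
parentPosition N = f0 , fs f0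
parentPosition M = fs f0 , f0
parentPosition E = fs f0 , fs f0
parentPosition _ = f0 , f0

parentPosition-topRight : ∀ z → parentPosition (block z f0 (fs f0)) ≡ position z
parentPosition-topRight A = refl
parentPosition-topRight B = refl
parentPosition-topRight C = refl
parentPosition-topRight D = refl
parentPosition-topRight E = refl
parentPosition-topRight F = refl
parentPosition-topRight G = refl
parentPosition-topRight H = refl
parentPosition-topRight I = refl
parentPosition-topRight J = refl
parentPosition-topRight K = refl
parentPosition-topRight L = refl
parentPosition-topRight M = refl
parentPosition-topRight N = refl
parentPosition-topRight O = refl
parentPosition-topRight P = refl

parentPosition-μ² : ∀ X a b → parentPosition (at (μ (μ X)) (2 * a + 0) (2 * b + 1)) ≡ (a mod 2 , b mod 2)
parentPosition-μ² X a b = begin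
  parentPosition (at (μ (μ X)) (2 * a + 0) (2 * b + 1))         ≡⟨ cong parentPosition (at-μ (μ X) a b 0 1) ⟩
  parentPosition (block (at (μ X) (a + 0) (b + 0)) f0 (fs f0))   ≡⟨ parentPosition-topRight (at (μ X) (a + 0) (b + 0)) ⟩
  position (at (μ X) (a + 0) (b + 0))                            ≡⟨ position-block (at X ((a + 0) / 2) ((b + 0) / 2)) _ _ ⟩
  ((a + 0) mod 2 , (b + 0) mod 2)                                ≡⟨ cong₂ (λ u v → u mod 2 , v mod 2) (+-identityʳ a) (+-identityʳ b) ⟩
  (a mod 2 , b mod 2)                                            ∎
  where open ≡-Reasoning

toℕ-mod2 : ∀ (l : Fin 2) → toℕ l mod 2 ≡ l
toℕ-mod2 f0      = refl
toℕ-mod2 (fs f0) = refl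

[k+i]mod2-injective : ∀ (i k k′ : Fin 2) → (toℕ k + toℕ i) mod 2 ≡ (toℕ k′ + toℕ i) mod 2 → k ≡ k′
[k+i]mod2-injective _       f0      f0      _  = refl
[k+i]mod2-injective _       (fs f0) (fs f0) _  = refl
[k+i]mod2-injective f0      f0      (fs f0) ()
[k+i]mod2-injective f0      (fs f0) f0      ()
[k+i]mod2-injective (fs f0) f0      (fs f0) ()
[k+i]mod2-injective (fs f0) (fs f0) f0      ()

Qij-probe : ∀ {m n Y} (i j k l : Fin 2) → 2 ≤ m → 2 ≤ n →
  Qij (toℕ i + 2 * toℕ k) (toℕ j + 2 * toℕ l) m n Y →
  parentPosition (at Y (toℕ i) (1 ∸ toℕ j)) ≡ ((toℕ k + toℕ i) mod 2 , l)
Qij-probe {m} {n} {Y} i j k l 2≤m 2≤n (x , _ , rows≡ , cols≡ , Y≐) = begin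
  parentPosition (at Y (toℕ i) (1 ∸ toℕ j))
    ≡⟨ cong parentPosition (Y≐ _ _ i<rows 1∸j<cols) ⟩
  parentPosition (at (μ (μ x)) (toℕ i + 2 * toℕ k + toℕ i) (toℕ j + 2 * toℕ l + (1 ∸ toℕ j)))
    ≡⟨ cong₂ (λ u v → parentPosition (at (μ (μ x)) u v)) (row (toℕ i) (toℕ k)) col ⟩
  parentPosition (at (μ (μ x)) (2 * (toℕ k + toℕ i) + 0) (2 * toℕ l + 1))
    ≡⟨ parentPosition-μ² x (toℕ k + toℕ i) (toℕ l) ⟩
  ((toℕ k + toℕ i) mod 2 , toℕ l mod 2)
    ≡⟨ cong ((toℕ k + toℕ i) mod 2 ,_) (toℕ-mod2 l) ⟩
  ((toℕ k + toℕ i) mod 2 , l)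
    ∎
  where
  open ≡-Reasoning
  i<rows : toℕ i < rows Y
  i<rows = subst (toℕ i <_) (sym rows≡) (<-≤-trans (toℕ<n i) 2≤m)
  1∸j<cols : 1 ∸ toℕ j < cols Y
  1∸j<cols = subst (1 ∸ toℕ j <_) (sym cols≡) (<-≤-trans (s≤s (m∸n≤m 1 (toℕ j))) 2≤n)
  row : ∀ a b → a + 2 * b + a ≡ 2 * (b + a) + 0
  row = solve-∀
  col : toℕ j + 2 * toℕ l + (1 ∸ toℕ j) ≡ 2 * toℕ l + 1
  col = begin
    toℕ j + 2 * toℕ l + (1 ∸ toℕ j)     ≡⟨ cong (_+ (1 ∸ toℕ j)) (+-comm (toℕ j) (2 * toℕ l)) ⟩
    2 * toℕ l + toℕ j + (1 ∸ toℕ j)     ≡⟨ +-assoc (2 * toℕ l) (toℕ j) (1 ∸ toℕ j) ⟩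
    2 * toℕ l + (toℕ j + (1 ∸ toℕ j))   ≡⟨ cong (2 * toℕ l +_) (m+[n∸m]≡n (toℕ≤pred[n] j)) ⟩
    2 * toℕ l + 1                       ∎

Qij-disjoint : ∀ {m n} (i j k l k′ l′ : Fin 2) → 2 ≤ m → 2 ≤ n → k ≢ k′ ⊎ l ≢ l′ → ∀ Y →
  Qij (toℕ i + 2 * toℕ k) (toℕ j + 2 * toℕ l) m n Y →
  Qij (toℕ i + 2 * toℕ k′) (toℕ j + 2 * toℕ l′) m n Y → ⊥
Qij-disjoint i j k l k′ l′ 2≤m 2≤n k≢k′⊎l≢l′ Y Y∈Q Y∈Q′ = separate k≢k′⊎l≢l′
  where
  probes : ((toℕ k + toℕ i) mod 2 , l) ≡ ((toℕ k′ + toℕ i) mod 2 , l′)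
  probes = trans (sym (Qij-probe i j k l 2≤m 2≤n Y∈Q)) (Qij-probe i j k′ l′ 2≤m 2≤n Y∈Q′)
  separate : k ≢ k′ ⊎ l ≢ l′ → ⊥
  separate (inj₁ k≢k′) = k≢k′ ([k+i]mod2-injective i k k′ (cong proj₁ probes))
  separate (inj₂ l≢l′) = l≢l′ (cong proj₂ probes)

lemma6 : (m n : ℕ) → 2 ≤ m → 2 ≤ n → (i j : Fin 2) →
    ((∀ Y → Pij (toℕ i) (toℕ j) m n Y →
        Σ (Fin 2) λ k → Σ (Fin 2) λ l →
          Qij (toℕ i + 2 * toℕ k) (toℕ j + 2 * toℕ l) m n Y) ×
     (∀ Y → (k l : Fin 2) →
        Qij (toℕ i + 2 * toℕ k) (toℕ j + 2 * toℕ l) m n Y →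
        Pij (toℕ i) (toℕ j) m n Y)) ×
    (∀ (k l : Fin 2) → ∃ λ Y →
        Qij (toℕ i + 2 * toℕ k) (toℕ j + 2 * toℕ l) m n Y) ×
    (∀ (k l k′ l′ : Fin 2) → (k ≢ k′ ⊎ l ≢ l′) → ∀ Y →
        Qij (toℕ i + 2 * toℕ k) (toℕ j + 2 * toℕ l) m n Y →
        Qij (toℕ i + 2 * toℕ k′) (toℕ j + 2 * toℕ l′) m n Y → ⊥)
lemma6 m n 2≤m 2≤n i j =
  ( Pij⊆⋃Qij (toℕ i) (toℕ j) 1≤m 1≤n (Fin2-toℕ≤ i 1≤m) (Fin2-toℕ≤ j 1≤n)
  , (λ Y k l → Qij⊆Pij (toℕ i) (toℕ j) (toℕ k) (toℕ l)
                 (Fin2-toℕ≤ i 1≤m) (Fin2-toℕ≤ j 1≤n) (Fin2-toℕ≤ k 1≤m) (Fin2-toℕ≤ l 1≤n) Y) )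
  , (λ k l → Qij-nonempty (toℕ i + 2 * toℕ k) (toℕ j + 2 * toℕ l) m n)
  , (λ k l k′ l′ → Qij-disjoint i j k l k′ l′ 2≤m 2≤n)
  where
  1≤m : 1 ≤ m
  1≤m = ≤-trans (s≤s z≤n) 2≤m
  1≤n : 1 ≤ n
  1≤n = ≤-trans (s≤s z≤n) 2≤n
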